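{- Let $G$ be a cubic graph of order $n$ and girth at least $5$. Then there is a linear ordering of the vertices of $G$ such that the greedy algorithm applied to this ordering yields a proper pushing scheme $\rho:V(G)\to\mathbb{N}_0$ with $$\sum_{u\in V(G)}\rho(u)\leq\left(3.5-\frac{23}{840}\right)n.$$
   Context: Graphs are finite, simple and undirected; $\mathbb{N}_0=\{0,1,2,\dots\}$; the girth is the length of a shortest cycle. For $\rho:V(G)\to\mathbb{N}_0$ define $\sigma_\rho(u)=(1+\rho(u))d_G(u)+\sum_{v\in N_G(u)}\rho(v)$; $\rho$ is a proper pushing scheme if $\sigma_\rho(u)\neq\sigma_\rho(v)$ for every edge $uv$. Greedy algorithm: given a linear ordering $u_1,\dots,u_n$ of $V(G)$, let $\rho_0\equiv 0$; for $i=1,\dots,n$, let $\rho_i$ agree with $\rho_{i-1}$ except at $u_i$, and set $\rho_i(u_i)$ to the smallest non-negative integer $s$ such that there is no edge $u_ju_k$ with $j,k\le i$ and $\sigma_{\rho_i}(u_j)=\sigma_{\rho_i}(u_k)$ (such an $s$ always exists for graphs with no component of order two). The output is $\rho_n$, a proper pushing scheme. -}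

module Defs where

open import Data.Nat using (ℕ; zero; suc; _+_; _*_; _<_; _≤_)
open import Data.Bool using (Bool; true; false; if_then_else_)
open import Data.Fin using (Fin; toℕ; _≟_)
open import Data.List using (List; map; allFin)
open import Data.Nat.ListAction using (sum)
open import Data.Product using (Σ; _×_; ∃; ∃-syntax)
open import Data.Empty using (⊥)
open import Relation.Nullary using (¬_; does)
open import Relation.Binary.PropositionalEquality using (_≡_; _≢_)
open import Data.Fin.Permutation using (Permutation′; _⟨$⟩ʳ_)

record Graph (n : ℕ) : Set where
  field
    adj    : Fin n → Fin n → Bool
    symm   : ∀ u v → adj u v ≡ adj v u
    irrefl : ∀ u → adj u u ≡ false
open Graph public

module _ {n : ℕ} (G : Graph n) where

  sumV : (Fin n → ℕ) → ℕ
  sumV f = sum (map f (allFin n))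

  sumN : Fin n → (Fin n → ℕ) → ℕ
  sumN u f = sumV (λ v → if adj G u v then f v else 0)

  degree : Fin n → ℕ
  degree u = sumN u (λ _ → 1)

  Cubic : Set
  Cubic = ∀ u → degree u ≡ 3

  NoTriangle : Set
  NoTriangle = ∀ a b c → adj G a b ≡ true → adj G b c ≡ true → adj G c a ≡ true → ⊥

  NoFourCycle : Set
  NoFourCycle = ∀ a b c d → a ≢ c → b ≢ d →
    adj G a b ≡ true → adj G b c ≡ true → adj G c d ≡ true → adj G d a ≡ true → ⊥

  GirthAtLeast5 : Set
  GirthAtLeast5 = NoTriangle × NoFourCycle

  σ : (Fin n → ℕ) → Fin n → ℕ
  σ ρ u = (1 + ρ u) * degree u + sumN u ρ

  ProperPushingScheme : (Fin n → ℕ) → Set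
  ProperPushingScheme ρ = ∀ u v → adj G u v ≡ true → σ ρ u ≢ σ ρ v

  update : (Fin n → ℕ) → Fin n → ℕ → Fin n → ℕ
  update ρ u s v = if does (v ≟ u) then s else ρ v

  module _ (π : Permutation′ n) where
    -- the ordering u_1,…,u_n is given (0-based) by positions p ↦ π ⟨$⟩ʳ p
    ord : Fin n → Fin n
    ord p = π ⟨$⟩ʳ p

    ConflictFree : (Fin n → ℕ) → ℕ → Set
    ConflictFree ρ m = ∀ p q → toℕ p < m → toℕ q < m →
      adj G (ord p) (ord q) ≡ true → σ ρ (ord p) ≢ σ ρ (ord q)

    -- ρs i is ρ_i of the greedy algorithm (i = 0,…,n).
    record GreedyRun (ρs : ℕ → Fin n → ℕ) : Set where
      field
        start : ∀ v → ρs 0 v ≡ 0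
        keep  : ∀ (p : Fin n) v → v ≢ ord p → ρs (suc (toℕ p)) v ≡ ρs (toℕ p) v
        valid : ∀ (p : Fin n) → ConflictFree (ρs (suc (toℕ p))) (suc (toℕ p))
        least : ∀ (p : Fin n) (s : ℕ) → s < ρs (suc (toℕ p)) (ord p) →
          ¬ ConflictFree (update (ρs (toℕ p)) (ord p) s) (suc (toℕ p))

-- Order the vertices as sources, then middle vertices, then sinks, where the sources form a maximal independent
-- set and the sinks an independent set. When the greedy algorithm fixes ρ(u), every earlier neighbour w of u
-- forbids at most one value (σ(u) = σ(w)), and so does every earlier neighbour x of w (σ(w) = σ(x)); as
-- deg u ≥ 2, each such equation has at most one solution. Keeping the constraints of the first kind at u and
-- charging those of the second kind to w, a vertex with k later neighbours carries (3 - k)(1 + k) + k(k - 1)/2 ≤ 4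
-- constraints, and only 3 if it is a source or a sink. Local search with potential 2·#sources + #sinks makes the
-- sources dominating, gives every middle vertex a sink neighbour and leaves no sink with two private middle
-- neighbours (middle neighbours whose only sink neighbour it is; this step uses triangle-freeness). Moving 132
-- from each source to each neighbour and 311 (156) from each sink to each private (non-private) middle neighbour
-- then turns the charges 840 · loadBound into charges of at most 2917 = 840 · (3.5 - 23/840).

module Submission where

open import Defs
open import Data.Nat using (ℕ; _*_; _≤_)
open import Data.Fin using (Fin)
open import Data.Product using (Σ; _×_; ∃; ∃-syntax)
open import Data.Fin.Permutation using (Permutation′)

open import Data.Nat.Properties
open import Algebra.Properties.CommutativeSemigroup +-commutativeSemigroup using (xy∙z≈zy∙x)
open import Algebra.Properties.Semiring.Sum +-*-semiring
  using (sum; sum-syntax; sum-cong-≗; sum-remove; ∑-distrib-+; ∑-comm)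
open import Data.Bool using (Bool; true; false; if_then_else_; not; _∧_)
import Data.Bool as Bool
open import Data.Empty using (⊥; ⊥-elim)
open import Data.Fin using (zero; suc; toℕ; fromℕ<; punchOut)
import Data.Fin as Fin
open import Data.Fin.Permutation using (permutation; _⟨$⟩ʳ_; _⟨$⟩ˡ_; inverseˡ; inverseʳ)
open import Data.Fin.Properties
  using (toℕ-injective; toℕ<n; toℕ-fromℕ<; any?; all?; punchInᵢ≢i; punchOut-injective; injective⇒≤)
open import Data.List using (map; allFin; tabulate)
open import Data.List.Properties using (map-tabulate)
open import Data.Nat using (zero; suc; _+_; _<_; z≤n; s≤s; s≤s⁻¹; _<ᵇ_; _<?_; _≤?_)
open import Data.Nat.ListAction using () renaming (sum to listSum)
open import Data.Nat.Tactic.RingSolver using (solve-∀)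
open import Data.Product using (Σ-syntax; _,_; proj₁; proj₂)
open import Data.Sum using (_⊎_; inj₁; inj₂)
open import Data.Vec.Functional using (removeAt; updateAt)
open import Data.Vec.Functional.Properties using (updateAt-updates; updateAt-minimal)
open import Function using (_∘_; id; const)
open import Relation.Binary.Definitions using (DecidableEquality; tri<; tri≈; tri>)
open import Relation.Binary.PropositionalEquality
open import Relation.Nullary using (¬_; does; yes; no; Dec; contradiction)
open import Relation.Nullary.Decidable
  using (toWitness; dec-true; dec-false; decidable-stable; _×-dec_; _⊎-dec_; _→-dec_; ¬?)
open import Relation.Nullary.Reflects using (ofʸ; ofⁿ)
open import Relation.Unary using (Decidable)

private variable
  n : ℕ

-- Finite sums over Fin n

listSum-tabulate : (f : Fin n → ℕ) → listSum (tabulate f) ≡ ∑[ i < n ] f i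
listSum-tabulate {zero} f = refl
listSum-tabulate {suc n} f = cong (f zero +_) (listSum-tabulate (f ∘ suc))

listSum-allFin : (f : Fin n → ℕ) → listSum (map f (allFin n)) ≡ ∑[ i < n ] f i
listSum-allFin f = trans (cong listSum (map-tabulate id f)) (listSum-tabulate f)

∑-mono-≤ : {f g : Fin n → ℕ} → (∀ i → f i ≤ g i) → sum f ≤ sum g
∑-mono-≤ {zero} f≤g = z≤n
∑-mono-≤ {suc n} f≤g = +-mono-≤ (f≤g zero) (∑-mono-≤ (f≤g ∘ suc))

∑-mono-< : {f g : Fin n → ℕ} → (∀ i → f i ≤ g i) → ∀ a → f a < g a → sum f < sum g
∑-mono-< f≤g zero fa<ga = +-mono-<-≤ fa<ga (∑-mono-≤ (f≤g ∘ suc))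
∑-mono-< f≤g (suc a) fa<ga = +-mono-≤-< (f≤g zero) (∑-mono-< (f≤g ∘ suc) a fa<ga)

∑-zero : ∀ n → ∑[ i < n ] 0 ≡ 0
∑-zero zero = refl
∑-zero (suc n) = ∑-zero n

∑-const : ∀ n c → ∑[ i < n ] c ≡ n * c
∑-const zero c = refl
∑-const (suc n) c = cong (c +_) (∑-const n c)

∑-*ˡ : ∀ c (f : Fin n → ℕ) → ∑[ i < n ] (c * f i) ≡ c * sum f
∑-*ˡ {zero} c f = sym (*-zeroʳ c)
∑-*ˡ {suc n} c f = trans (cong (c * f zero +_) (∑-*ˡ c (f ∘ suc))) (sym (*-distribˡ-+ c (f zero) _))

∑<n⇒∃≡0 : (f : Fin n → ℕ) → sum f < n → ∃[ i ] f i ≡ 0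
∑<n⇒∃≡0 {suc n} f ∑f<n with f zero in f₀≡
... | zero = zero , f₀≡
... | suc k with ∑<n⇒∃≡0 (f ∘ suc) (≤-trans (s≤s (m≤n+m _ k)) (s≤s⁻¹ ∑f<n))
...   | i , fi≡0 = suc i , fi≡0

∑≡0⇒≡0 : (f : Fin n → ℕ) → sum f ≡ 0 → ∀ i → f i ≡ 0
∑≡0⇒≡0 f ∑f≡0 zero = m+n≡0⇒m≡0 (f zero) ∑f≡0
∑≡0⇒≡0 f ∑f≡0 (suc i) = ∑≡0⇒≡0 (f ∘ suc) (m+n≡0⇒n≡0 (f zero) ∑f≡0) i

∑-indicator : ∀ (a : Fin n) c → ∑[ i < n ] (if does (i Fin.≟ a) then c else 0) ≡ c
∑-indicator {suc n} zero c = trans (cong (c +_) (∑-zero n)) (+-identityʳ c)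
∑-indicator {suc n} (suc a) c = trans (sum-cong-≗ shift) (∑-indicator a c)
  where
  shift : ∀ i → (if does (suc i Fin.≟ suc a) then c else 0) ≡ (if does (i Fin.≟ a) then c else 0)
  shift i with i Fin.≟ a
  ... | yes _ = refl
  ... | no _ = refl

∑-agree : {f g : Fin n → ℕ} (i : Fin n) → (∀ j → j ≢ i → f j ≡ g j) → sum f + g i ≡ sum g + f i
∑-agree {suc n} {f} {g} i f≡g = begin
  sum f + g i                          ≡⟨ cong (_+ g i) (sum-remove {i = i} f) ⟩
  f i + sum (removeAt f i) + g i       ≡⟨ cong (λ r → f i + r + g i) (sum-cong-≗ λ j → f≡g _ (punchInᵢ≢i i j)) ⟩
  f i + sum (removeAt g i) + g i       ≡⟨ xy∙z≈zy∙x (f i) _ (g i) ⟩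
  g i + sum (removeAt g i) + f i       ≡⟨ cong (_+ f i) (sum-remove {i = i} g) ⟨
  sum g + f i                          ∎
  where
  open ≡-Reasoning

𝟙 : Bool → ℕ
𝟙 b = if b then 1 else 0

𝟙≤1 : ∀ b → 𝟙 b ≤ 1
𝟙≤1 true = ≤-refl
𝟙≤1 false = z≤n

does≡true⇒ : {P : Set} (d : Dec P) → does d ≡ true → P
does≡true⇒ (yes p) _ = p

𝟙≡0⇒¬ : {P : Set} (d : Dec P) → 𝟙 (does d) ≡ 0 → ¬ P
𝟙≡0⇒¬ (no ¬p) _ = ¬p

∑-𝟙-atMostOne : ∀ K {P : ℕ → Set} (P? : Decidable P) → (∀ {s t} → P s → P t → s ≡ t) →
  ∑[ s < K ] 𝟙 (does (P? (toℕ s))) ≤ 1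
∑-𝟙-atMostOne zero P? unique = z≤n
∑-𝟙-atMostOne (suc K) P? unique with P? 0
... | yes p0 = ≤-reflexive (cong suc rest≡0)
  where
  none : (s : Fin K) → 𝟙 (does (P? (suc (toℕ s)))) ≡ 0
  none s = cong 𝟙 (dec-false (P? _) λ ps → 0≢1+n (unique p0 ps))
  rest≡0 : ∑[ s < K ] 𝟙 (does (P? (suc (toℕ s)))) ≡ 0
  rest≡0 = trans (sum-cong-≗ none) (∑-zero K)
... | no _ = ∑-𝟙-atMostOne K (P? ∘ suc) (λ ps pt → suc-injective (unique ps pt))

<ᵇ-true : ∀ {m n} → m < n → (m <ᵇ n) ≡ true
<ᵇ-true {m} {n} m<n with m <ᵇ n | <ᵇ-reflects-< m n
... | true | _ = refl
... | false | ofⁿ m≮n = contradiction m<n m≮n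

<ᵇ-false : ∀ {m n} → ¬ m < n → (m <ᵇ n) ≡ false
<ᵇ-false {m} {n} m≮n with m <ᵇ n | <ᵇ-reflects-< m n
... | true | ofʸ m<n = contradiction m<n m≮n
... | false | _ = refl

<ᵇ-flip : ∀ {m n} → m ≢ n → (n <ᵇ m) ≡ not (m <ᵇ n)
<ᵇ-flip {m} {n} m≢n with <-cmp m n
... | tri< m<n _ n≮m = trans (<ᵇ-false n≮m) (cong not (sym (<ᵇ-true m<n)))
... | tri≈ _ m≡n _ = contradiction m≡n m≢n
... | tri> m≮n _ n<m = trans (<ᵇ-true n<m) (cong not (sym (<ᵇ-false m≮n)))

restrict : (Fin n → Bool) → (Fin n → ℕ) → Fin n → ℕ
restrict p f v = if p v then f v else 0

sumOver : (Fin n → Bool) → (Fin n → ℕ) → ℕ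
sumOver p f = sum (restrict p f)

infixl 10 sumOver
syntax sumOver p (λ v → e) = ∑[ v ∈ p ] e

count : (Fin n → Bool) → ℕ
count p = ∑[ _ ∈ p ] 1

module _ (p : Fin n → Bool) where

  sumOver-cong : {f g : Fin n → ℕ} → (∀ v → p v ≡ true → f v ≡ g v) → sumOver p f ≡ sumOver p g
  sumOver-cong f≡g = sum-cong-≗ pointwise
    where
    pointwise : ∀ v → (if p v then _ else 0) ≡ (if p v then _ else 0)
    pointwise v with p v in pv
    ... | true = f≡g v pv
    ... | false = refl

  sumOver-mono : {f g : Fin n → ℕ} → (∀ v → p v ≡ true → f v ≤ g v) → sumOver p f ≤ sumOver p g
  sumOver-mono f≤g = ∑-mono-≤ pointwise
    where
    pointwise : ∀ v → (if p v then _ else 0) ≤ (if p v then _ else 0)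
    pointwise v with p v in pv
    ... | true = f≤g v pv
    ... | false = z≤n

  sumOver-≡0 : (f : Fin n → ℕ) → sumOver p f ≡ 0 → ∀ v → p v ≡ true → f v ≡ 0
  sumOver-≡0 f ∑≡0 v pv = subst (λ b → (if b then f v else 0) ≡ 0) pv (∑≡0⇒≡0 _ ∑≡0 v)

  sumOver-+ : (f g : Fin n → ℕ) → ∑[ v ∈ p ] (f v + g v) ≡ sumOver p f + sumOver p g
  sumOver-+ f g = trans (sum-cong-≗ pointwise) (∑-distrib-+ (restrict p f) (restrict p g))
    where
    pointwise : ∀ v → (if p v then f v + g v else 0) ≡ (if p v then f v else 0) + (if p v then g v else 0)
    pointwise v with p v
    ... | true = refl
    ... | false = refl

  ∑-sumOver : ∀ {m} (f : Fin m → Fin n → ℕ) → ∑[ s < m ] sumOver p (f s) ≡ ∑[ v ∈ p ] ∑[ s < m ] f s v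
  ∑-sumOver {m} f = trans (∑-comm (λ s → restrict p (f s))) (sum-cong-≗ pointwise)
    where
    pointwise : ∀ v → ∑[ s < m ] (if p v then f s v else 0) ≡ (if p v then ∑[ s < m ] f s v else 0)
    pointwise v with p v
    ... | true = refl
    ... | false = ∑-zero m

  sumOver-empty : (∀ v → p v ≡ false) → (f : Fin n → ℕ) → sumOver p f ≡ 0
  sumOver-empty empty f = trans (sum-cong-≗ pointwise) (∑-zero n)
    where
    pointwise : ∀ v → (if p v then f v else 0) ≡ 0
    pointwise v rewrite empty v = refl

  sumOver-∧ : (q : Fin n → Bool) (f : Fin n → ℕ) → ∑[ v ∈ (λ v → p v ∧ q v) ] f v ≡ ∑[ v ∈ p ] (if q v then f v else 0)
  sumOver-∧ q f = sum-cong-≗ pointwise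
    where
    pointwise : ∀ v → (if p v ∧ q v then f v else 0) ≡ (if p v then (if q v then f v else 0) else 0)
    pointwise v with p v
    ... | true = refl
    ... | false = refl

  count≡0⇒empty : count p ≡ 0 → ∀ v → p v ≡ false
  count≡0⇒empty count≡0 v with p v in pv
  ... | true = contradiction (sumOver-≡0 _ count≡0 v pv) λ ()
  ... | false = refl

_∖_ : (Fin n → Bool) → Fin n → Fin n → Bool
(p ∖ a) v = p v ∧ not (does (v Fin.≟ a))

module _ (p : Fin n → Bool) {a : Fin n} where

  ∖-sound : ∀ {v} → (p ∖ a) v ≡ true → p v ≡ true × v ≢ a
  ∖-sound {v} p∖a with p v | v Fin.≟ a
  ... | true | no v≢a = refl , v≢a

  ∖-cases : ∀ {v} → p v ≡ true → v ≡ a ⊎ (p ∖ a) v ≡ true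
  ∖-cases {v} pv with v Fin.≟ a
  ... | yes v≡a = inj₁ v≡a
  ... | no _ = inj₂ (cong (_∧ true) pv)

  sumOver-remove : p a ≡ true → (f : Fin n → ℕ) → sumOver p f ≡ f a + sumOver (p ∖ a) f
  sumOver-remove pa f = begin
    sumOver p f                               ≡⟨ sum-cong-≗ split ⟩
    ∑[ v < n ] (at-a v + restrict (p ∖ a) f v)  ≡⟨ ∑-distrib-+ at-a (restrict (p ∖ a) f) ⟩
    ∑[ v < n ] at-a v + sumOver (p ∖ a) f      ≡⟨ cong (_+ sumOver (p ∖ a) f) (∑-indicator a (f a)) ⟩
    f a + sumOver (p ∖ a) f                   ∎
    where
    open ≡-Reasoning
    at-a : Fin n → ℕ
    at-a v = if does (v Fin.≟ a) then f a else 0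
    split : ∀ v → (if p v then f v else 0) ≡ at-a v + restrict (p ∖ a) f v
    split v with v Fin.≟ a
    ... | yes refl rewrite pa = sym (+-identityʳ (f v))
    ... | no _ with p v
    ...   | true = refl
    ...   | false = refl

  ≤-sumOver : p a ≡ true → (f : Fin n → ℕ) → f a ≤ sumOver p f
  ≤-sumOver pa f = subst (f a ≤_) (sym (sumOver-remove pa f)) (m≤m+n (f a) _)

  count-remove : p a ≡ true → count p ≡ suc (count (p ∖ a))
  count-remove pa = sumOver-remove pa (λ _ → 1)

count≡suc⇒∃ : {p : Fin n → Bool} {k : ℕ} → count p ≡ suc k → ∃[ a ] (p a ≡ true × count (p ∖ a) ≡ k)
count≡suc⇒∃ {p = p} count≡ with any? (λ v → p v Bool.≟ true)
... | yes (a , pa) = a , pa , suc-injective (trans (sym (count-remove p pa)) count≡)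
... | no none = contradiction (trans (sym count≡) (sumOver-empty p nowhere (λ _ → 1))) λ ()
  where
  nowhere : ∀ v → p v ≡ false
  nowhere v with p v in pv
  ... | true = contradiction (v , pv) none
  ... | false = refl

record ThreeElements (p : Fin n → Bool) : Set where
  field
    a b c : Fin n
    a≢b : a ≢ b
    a≢c : a ≢ c
    b≢c : b ≢ c
    pa : p a ≡ true
    pb : p b ≡ true
    pc : p c ≡ true
    elements : ∀ {v} → p v ≡ true → v ≡ a ⊎ v ≡ b ⊎ v ≡ c
    sumOver-elements : (f : Fin n → ℕ) → sumOver p f ≡ f a + f b + f c

count≡3⇒ThreeElements : {p : Fin n → Bool} → count p ≡ 3 → ThreeElements p
count≡3⇒ThreeElements {n} {p} count≡3
  with a , pa , count≡2 ← count≡suc⇒∃ count≡3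
  with b , p∖a-b , count≡1 ← count≡suc⇒∃ count≡2
  with c , p∖a∖b-c , count≡0 ← count≡suc⇒∃ count≡1
  with pb , b≢a ← ∖-sound p p∖a-b
  with p∖a-c , c≢b ← ∖-sound (p ∖ a) p∖a∖b-c
  with pc , c≢a ← ∖-sound p p∖a-c = record
    { a≢b = λ a≡b → b≢a (sym a≡b)
    ; a≢c = λ a≡c → c≢a (sym a≡c)
    ; b≢c = λ b≡c → c≢b (sym b≡c)
    ; pa = pa ; pb = pb ; pc = pc
    ; elements = elements
    ; sumOver-elements = sumOver-elements
    }
  where
  rest : Fin n → Bool
  rest = ((p ∖ a) ∖ b) ∖ c

  elements : ∀ {v} → p v ≡ true → v ≡ a ⊎ v ≡ b ⊎ v ≡ c
  elements pv with ∖-cases p pv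
  ... | inj₁ v≡a = inj₁ v≡a
  ... | inj₂ p∖a-v with ∖-cases (p ∖ a) p∖a-v
  ...   | inj₁ v≡b = inj₂ (inj₁ v≡b)
  ...   | inj₂ p∖a∖b-v with ∖-cases ((p ∖ a) ∖ b) p∖a∖b-v
  ...     | inj₁ v≡c = inj₂ (inj₂ v≡c)
  ...     | inj₂ rest-v = contradiction (trans (sym rest-v) (count≡0⇒empty rest count≡0 _)) λ ()

  sumOver-elements : (f : Fin n → ℕ) → sumOver p f ≡ f a + f b + f c
  sumOver-elements f = begin
    sumOver p f                                  ≡⟨ sumOver-remove p pa f ⟩
    f a + sumOver (p ∖ a) f                      ≡⟨ cong (f a +_) (sumOver-remove (p ∖ a) p∖a-b f) ⟩
    f a + (f b + sumOver ((p ∖ a) ∖ b) f)        ≡⟨ cong (λ x → f a + (f b + x)) (sumOver-remove ((p ∖ a) ∖ b) p∖a∖b-c f) ⟩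
    f a + (f b + (f c + sumOver rest f))         ≡⟨ cong (λ x → f a + (f b + (f c + x))) (sumOver-empty rest (count≡0⇒empty rest count≡0) f) ⟩
    f a + (f b + (f c + 0))                      ≡⟨ cong (λ x → f a + (f b + x)) (+-identityʳ (f c)) ⟩
    f a + (f b + f c)                            ≡⟨ +-assoc (f a) (f b) (f c) ⟨
    f a + f b + f c                              ∎
    where open ≡-Reasoning

-- Graphs and single updates of ρ

module GraphBasics {n : ℕ} (G : Graph n) where

  adj⇒≢ : ∀ {u v} → adj G u v ≡ true → u ≢ v
  adj⇒≢ {u} uv refl = contradiction (trans (sym uv) (irrefl G u)) λ ()

  sumN≡sumOver : ∀ u f → sumN G u f ≡ sumOver (adj G u) f
  sumN≡sumOver u f = listSum-allFin (restrict (adj G u) f)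

  degree≡count : ∀ u → degree G u ≡ count (adj G u)
  degree≡count u = sumN≡sumOver u (λ _ → 1)

  σ-cong : ∀ {ρ ρ′} → (∀ v → ρ v ≡ ρ′ v) → ∀ u → σ G ρ u ≡ σ G ρ′ u
  σ-cong {ρ} {ρ′} ρ≗ρ′ u = cong₂ _+_ (cong (λ r → (1 + r) * degree G u) (ρ≗ρ′ u)) (begin
    sumN G u ρ         ≡⟨ sumN≡sumOver u ρ ⟩
    sumOver (adj G u) ρ  ≡⟨ sumOver-cong (adj G u) (λ v _ → ρ≗ρ′ v) ⟩
    sumOver (adj G u) ρ′ ≡⟨ sumN≡sumOver u ρ′ ⟨
    sumN G u ρ′        ∎)
    where open ≡-Reasoning

  module _ (ρ : Fin n → ℕ) (u : Fin n) (s : ℕ) where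

    update-self : update G ρ u s u ≡ s
    update-self = cong (if_then s else ρ u) (dec-true (u Fin.≟ u) refl)

    update-other : ∀ {v} → v ≢ u → update G ρ u s v ≡ ρ v
    update-other v≢u = cong (if_then s else _) (dec-false (_ Fin.≟ u) v≢u)

    sumN-update : ∀ v → sumN G v (update G ρ u s) + (if adj G v u then ρ u else 0) ≡ sumN G v ρ + (if adj G v u then s else 0)
    sumN-update v = begin
      sumN G v (update G ρ u s) + (if adj G v u then ρ u else 0)
        ≡⟨ cong (_+ _) (sumN≡sumOver v _) ⟩
      sumOver (adj G v) (update G ρ u s) + (if adj G v u then ρ u else 0)
        ≡⟨ ∑-agree u (λ x x≢u → cong (if adj G v x then_else 0) (update-other x≢u)) ⟩
      sumOver (adj G v) ρ + (if adj G v u then update G ρ u s u else 0)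
        ≡⟨ cong₂ _+_ (sumN≡sumOver v ρ) (cong (if adj G v u then_else 0) (sym update-self)) ⟨
      sumN G v ρ + (if adj G v u then s else 0) ∎
      where open ≡-Reasoning

    σ-update-self : σ G (update G ρ u s) u ≡ (1 + s) * degree G u + sumN G u ρ
    σ-update-self = cong₂ _+_ (cong (λ r → (1 + r) * degree G u) update-self) (+-cancelʳ-≡ 0 _ _ sumN-self)
      where
      sumN-self : sumN G u (update G ρ u s) + 0 ≡ sumN G u ρ + 0
      sumN-self = subst (λ b → sumN G u (update G ρ u s) + (if b then ρ u else 0) ≡ sumN G u ρ + (if b then s else 0))
                        (irrefl G u) (sumN-update u)

    σ-update : ρ u ≡ 0 → ∀ {v} → v ≢ u → σ G (update G ρ u s) v ≡ σ G ρ v + (if adj G v u then s else 0)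
    σ-update ρu≡0 {v} v≢u = begin
      (1 + update G ρ u s v) * degree G v + sumN G v (update G ρ u s)
        ≡⟨ cong₂ _+_ (cong (λ r → (1 + r) * degree G v) (update-other v≢u)) sumN-updated ⟩
      (1 + ρ v) * degree G v + (sumN G v ρ + (if adj G v u then s else 0))
        ≡⟨ +-assoc ((1 + ρ v) * degree G v) (sumN G v ρ) _ ⟨
      σ G ρ v + (if adj G v u then s else 0) ∎
      where
      open ≡-Reasoning
      no-old : (if adj G v u then ρ u else 0) ≡ 0
      no-old with adj G v u
      ... | true = ρu≡0
      ... | false = refl
      sumN-updated : sumN G v (update G ρ u s) ≡ sumN G v ρ + (if adj G v u then s else 0)
      sumN-updated = trans (sym (trans (cong (sumN G v (update G ρ u s) +_) no-old) (+-identityʳ _))) (sumN-update v)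

module CubicGraph {n : ℕ} (G : Graph n) (cubic : Cubic G) where

  open GraphBasics G

  neighbours : ∀ w → ThreeElements (adj G w)
  neighbours w = count≡3⇒ThreeElements (trans (sym (degree≡count w)) (cubic w))

-- The greedy algorithm

least : {P : ℕ → Set} → Decidable P → ℕ → ℕ
least P? zero = zero
least P? (suc K) = if does (P? 0) then 0 else suc (least (P? ∘ suc) K)

least-spec : {P : ℕ → Set} (P? : Decidable P) (K : ℕ) {s : ℕ} → s < K → P s →
  P (least P? K) × least P? K ≤ s × (∀ {t} → t < least P? K → ¬ P t)
least-spec P? (suc K) {s} s<K ps with P? 0
... | yes p0 = p0 , z≤n , λ ()
least-spec P? (suc K) {zero} s<K ps | no ¬p0 = contradiction ps ¬p0
least-spec {P} P? (suc K) {suc s} s<K ps | no ¬p0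
  with p , l≤s , below ← least-spec (P? ∘ suc) K (s≤s⁻¹ s<K) ps = p , s≤s l≤s , below′
  where
  below′ : ∀ {t} → t < suc (least (P? ∘ suc) K) → ¬ P t
  below′ {zero} _ = ¬p0
  below′ {suc t} t<l = below (s≤s⁻¹ t<l)

module GreedyAlgorithm {n : ℕ} (G : Graph n) (π : Permutation′ n) where

  open GraphBasics G

  pos : Fin n → ℕ
  pos v = toℕ (π ⟨$⟩ˡ v)

  pos-ord : ∀ p → pos (ord G π p) ≡ toℕ p
  pos-ord p = cong toℕ (inverseˡ π)

  pos-injective : ∀ {v w} → pos v ≡ pos w → v ≡ w
  pos-injective eq = trans (sym (inverseʳ π)) (trans (cong (π ⟨$⟩ʳ_) (toℕ-injective eq)) (inverseʳ π))

  conflictFree? : ∀ ρ m → Dec (ConflictFree G π ρ m)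
  conflictFree? ρ m = all? λ p → all? λ q → (toℕ p <? m) →-dec ((toℕ q <? m) →-dec
    ((adj G (ord G π p) (ord G π q) Bool.≟ true) →-dec ¬? (σ G ρ (ord G π p) ≟ σ G ρ (ord G π q))))

  conflictFree-cong : ∀ {ρ ρ′} m → (∀ v → ρ v ≡ ρ′ v) → ConflictFree G π ρ m → ConflictFree G π ρ′ m
  conflictFree-cong m ρ≗ρ′ cf p q p<m q<m pq eq = cf p q p<m q<m pq (trans (σ-cong ρ≗ρ′ _) (trans eq (sym (σ-cong ρ≗ρ′ _))))

  conflictFree-vertices : ∀ {ρ m} → ConflictFree G π ρ m → ∀ {v w} → pos v < m → pos w < m → adj G v w ≡ true → σ G ρ v ≢ σ G ρ w
  conflictFree-vertices {ρ} cf {v} {w} v<m w<m vw = subst₂ (λ x y → σ G ρ x ≢ σ G ρ y) (inverseʳ π) (inverseʳ π)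
    (cf (π ⟨$⟩ˡ v) (π ⟨$⟩ˡ w) v<m w<m (subst₂ (λ x y → adj G x y ≡ true) (sym (inverseʳ π)) (sym (inverseʳ π)) vw))

  earlierNbr : ℕ → Fin n → Fin n → Bool
  earlierNbr i v w = adj G v w ∧ (pos w <ᵇ i)

  earlierNbr-complete : ∀ {i v w} → adj G v w ≡ true → pos w < i → earlierNbr i v w ≡ true
  earlierNbr-complete vw w<i rewrite vw = <ᵇ-true w<i

  greedyBound : ℕ → Fin n → ℕ
  greedyBound i u = ∑[ w ∈ earlierNbr i u ] suc (count (earlierNbr i w))

  Admissible : (Fin n → ℕ) → Fin n → ℕ → Set
  Admissible ρ u s = ∀ {w} → earlierNbr (pos u) u w ≡ true →
      σ G ρ w + s ≢ (1 + s) * degree G u + sumN G u ρ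
    × (∀ {x} → earlierNbr (pos u) w x ≡ true → σ G ρ w + s ≢ σ G ρ x)

  admissible⇒conflictFree : ∀ {ρ u s} → ConflictFree G π ρ (pos u) → ρ u ≡ 0 → Admissible ρ u s →
    ConflictFree G π (update G ρ u s) (suc (pos u))
  admissible⇒conflictFree {ρ} {u} {s} cf ρu≡0 admissible p q p< q< pq =
    distinct (subst (_< suc (pos u)) (sym (pos-ord p)) p<) (subst (_< suc (pos u)) (sym (pos-ord q)) q<) pq
    where
    ρ′ : Fin n → ℕ
    ρ′ = update G ρ u s

    σ′-earlier : ∀ {v} → pos v < pos u → σ G ρ′ v ≡ σ G ρ v + (if adj G v u then s else 0)
    σ′-earlier v<u = σ-update ρ u s ρu≡0 λ { refl → <-irrefl refl v<u }

    u-vs-earlier : ∀ {w} → adj G u w ≡ true → pos w < pos u → σ G ρ′ u ≢ σ G ρ′ w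
    u-vs-earlier {w} uw w<u eq = proj₁ (admissible (earlierNbr-complete uw w<u)) (begin
      σ G ρ w + s                            ≡⟨ cong (λ b → σ G ρ w + (if b then s else 0)) (trans (symm G w u) uw) ⟨
      σ G ρ w + (if adj G w u then s else 0) ≡⟨ σ′-earlier w<u ⟨
      σ G ρ′ w                               ≡⟨ eq ⟨
      σ G ρ′ u                               ≡⟨ σ-update-self ρ u s ⟩
      (1 + s) * degree G u + sumN G u ρ      ∎)
      where open ≡-Reasoning

    both-earlier : ∀ {v w} → pos v < pos u → pos w < pos u → adj G v w ≡ true → σ G ρ′ v ≢ σ G ρ′ w
    both-earlier {v} {w} v<u w<u vw rewrite σ′-earlier v<u | σ′-earlier w<u with adj G v u in vu | adj G w u in wu
    ... | true | true = conflictFree-vertices cf v<u w<u vw ∘ +-cancelʳ-≡ _ _ _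
    ... | true | false = proj₂ (admissible (earlierNbr-complete (trans (symm G u v) vu) v<u)) (earlierNbr-complete vw w<u)
                          ∘ (λ eq → trans eq (+-identityʳ _))
    ... | false | true = λ eq → proj₂ (admissible (earlierNbr-complete (trans (symm G u w) wu) w<u)) (earlierNbr-complete (trans (symm G w v) vw) v<u)
                          (sym (trans (sym (+-identityʳ _)) eq))
    ... | false | false = conflictFree-vertices cf v<u w<u vw ∘ +-cancelʳ-≡ _ _ _

    earlier-or-u : ∀ {v} → pos v < suc (pos u) → pos v < pos u ⊎ v ≡ u
    earlier-or-u v≤u with m<1+n⇒m<n∨m≡n v≤u
    ... | inj₁ v<u = inj₁ v<u
    ... | inj₂ v≡u = inj₂ (pos-injective v≡u)

    distinct : ∀ {v w} → pos v < suc (pos u) → pos w < suc (pos u) → adj G v w ≡ true → σ G ρ′ v ≢ σ G ρ′ w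
    distinct v≤u w≤u vw with earlier-or-u v≤u | earlier-or-u w≤u
    ... | inj₂ refl | inj₂ refl = contradiction refl (adj⇒≢ vw)
    ... | inj₂ refl | inj₁ w<u = u-vs-earlier vw w<u
    ... | inj₁ v<u | inj₂ refl = u-vs-earlier (trans (symm G u _) vw) v<u ∘ sym
    ... | inj₁ v<u | inj₁ w<u = both-earlier v<u w<u vw

  module Blocking (ρ : Fin n → ℕ) (u : Fin n) where

    blocksSelf? : ∀ w s → Dec (σ G ρ w + s ≡ (1 + s) * degree G u + sumN G u ρ)
    blocksSelf? w s = σ G ρ w + s ≟ (1 + s) * degree G u + sumN G u ρ

    blocksPair? : ∀ w x s → Dec (σ G ρ w + s ≡ σ G ρ x)
    blocksPair? w x s = σ G ρ w + s ≟ σ G ρ x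

    pairBlockers : Fin n → ℕ → ℕ
    pairBlockers w s = ∑[ x ∈ earlierNbr (pos u) w ] 𝟙 (does (blocksPair? w x s))

    blockers : Fin n → ℕ → ℕ
    blockers w s = 𝟙 (does (blocksSelf? w s)) + pairBlockers w s

    blocked : ℕ → ℕ
    blocked s = ∑[ w ∈ earlierNbr (pos u) u ] blockers w s

    -- σ(w) + s = (1 + s)(2 + e) + N rearranges to σ(w) = (1 + s)(1 + e) + (1 + N), which is strictly increasing in s.
    blocksSelf-unique : 2 ≤ degree G u → ∀ {w s t} → σ G ρ w + s ≡ (1 + s) * degree G u + sumN G u ρ →
      σ G ρ w + t ≡ (1 + t) * degree G u + sumN G u ρ → s ≡ t
    blocksSelf-unique 2≤d {w} {s} {t} es et with degree G u | 2≤d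
    ... | suc zero | s≤s ()
    ... | suc (suc e) | _ = suc-injective (*-cancelʳ-≡ (1 + s) (1 + t) (1 + e)
          (+-cancelʳ-≡ (1 + sumN G u ρ) _ _ (trans (sym (solved s es)) (solved t et))))
      where
      rearrange : ∀ s e N → (1 + s) * (2 + e) + N ≡ (1 + s) * (1 + e) + (1 + N) + s
      rearrange = solve-∀
      solved : ∀ r → σ G ρ w + r ≡ (1 + r) * (2 + e) + sumN G u ρ → σ G ρ w ≡ (1 + r) * (1 + e) + (1 + sumN G u ρ)
      solved r er = +-cancelʳ-≡ r _ _ (trans er (rearrange r e (sumN G u ρ)))

    ∑-blocked : 2 ≤ degree G u → ∀ K → ∑[ s < K ] blocked (toℕ s) ≤ greedyBound (pos u) u
    ∑-blocked 2≤d K = begin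
      ∑[ s < K ] blocked (toℕ s)                                ≡⟨ ∑-sumOver (earlierNbr (pos u) u) (λ (s : Fin K) w → blockers w (toℕ s)) ⟩
      ∑[ w ∈ earlierNbr (pos u) u ] ∑[ s < K ] blockers w (toℕ s) ≤⟨ sumOver-mono (earlierNbr (pos u) u) (λ w _ → ∑-blockers w) ⟩
      greedyBound (pos u) u                                     ∎
      where
      open ≤-Reasoning
      ∑-blockers : ∀ w → ∑[ s < K ] blockers w (toℕ s) ≤ suc (count (earlierNbr (pos u) w))
      ∑-blockers w = begin
        ∑[ s < K ] blockers w (toℕ s)
          ≡⟨ ∑-distrib-+ (λ (s : Fin K) → 𝟙 (does (blocksSelf? w (toℕ s)))) (λ s → pairBlockers w (toℕ s)) ⟩
        ∑[ s < K ] 𝟙 (does (blocksSelf? w (toℕ s))) + ∑[ s < K ] pairBlockers w (toℕ s)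
          ≡⟨ cong (∑[ s < K ] 𝟙 (does (blocksSelf? w (toℕ s))) +_)
                  (∑-sumOver (earlierNbr (pos u) w) λ (s : Fin K) x → 𝟙 (does (blocksPair? w x (toℕ s)))) ⟩
        ∑[ s < K ] 𝟙 (does (blocksSelf? w (toℕ s))) + ∑[ x ∈ earlierNbr (pos u) w ] ∑[ s < K ] 𝟙 (does (blocksPair? w x (toℕ s)))
          ≤⟨ +-mono-≤ (∑-𝟙-atMostOne K (blocksSelf? w) (blocksSelf-unique 2≤d))
                      (sumOver-mono (earlierNbr (pos u) w) λ x _ →
                         ∑-𝟙-atMostOne K (blocksPair? w x) λ es et → +-cancelˡ-≡ _ _ _ (trans es (sym et))) ⟩
        suc (count (earlierNbr (pos u) w)) ∎

    unblocked⇒admissible : ∀ {s} → blocked s ≡ 0 → Admissible ρ u s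
    unblocked⇒admissible {s} blocked≡0 {w} uw = 𝟙≡0⇒¬ (blocksSelf? w s) (m+n≡0⇒m≡0 _ term≡0)
      , λ {x} wx → 𝟙≡0⇒¬ (blocksPair? w x s)
                     (sumOver-≡0 (earlierNbr (pos u) w) (λ x → 𝟙 (does (blocksPair? w x s))) (m+n≡0⇒n≡0 _ term≡0) x wx)
      where
      term≡0 : blockers w s ≡ 0
      term≡0 = sumOver-≡0 (earlierNbr (pos u) u) (λ w → blockers w s) blocked≡0 w uw

  admissible-exists : ∀ {u} → 2 ≤ degree G u → ∀ ρ → ∃[ s ] (s ≤ greedyBound (pos u) u × Admissible ρ u s)
  admissible-exists {u} 2≤d ρ =
    let s , blocked≡0 = ∑<n⇒∃≡0 (blocked ∘ toℕ) (s≤s (∑-blocked 2≤d (suc (greedyBound (pos u) u))))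
    in toℕ s , s≤s⁻¹ (toℕ<n s) , unblocked⇒admissible blocked≡0
    where open Blocking ρ u

  choice : ℕ → (Fin n → ℕ) → Fin n → ℕ
  choice i ρ u = least (λ s → conflictFree? (update G ρ u s) (suc i)) (suc (greedyBound i u))

  GoodChoice : ℕ → (Fin n → ℕ) → Fin n → ℕ → Set
  GoodChoice i ρ u c = ConflictFree G π (update G ρ u c) (suc i)
    × c ≤ greedyBound i u
    × (∀ {t} → t < c → ¬ ConflictFree G π (update G ρ u t) (suc i))

  choice-spec : ∀ {i ρ u} → pos u ≡ i → 2 ≤ degree G u → ConflictFree G π ρ i → ρ u ≡ 0 → GoodChoice i ρ u (choice i ρ u)
  choice-spec {ρ = ρ} {u} refl 2≤d cf ρu≡0 =
    let s , s≤bound , admissible = admissible-exists 2≤d ρ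
        conflictFree , c≤s , below = least-spec {λ s → ConflictFree G π (update G ρ u s) (suc (pos u))}
          (λ s → conflictFree? (update G ρ u s) (suc (pos u))) (suc (greedyBound (pos u) u)) (s≤s s≤bound)
          (admissible⇒conflictFree cf ρu≡0 admissible)
    in conflictFree , ≤-trans c≤s s≤bound , below

  ρs : ℕ → Fin n → ℕ
  ρs zero v = 0
  ρs (suc i) v = if does (pos v ≟ i) then choice i (ρs i) v else ρs i v

  ρs-here : ∀ {v i} → pos v ≡ i → ρs (suc i) v ≡ choice i (ρs i) v
  ρs-here {v} {i} v-at-i = cong (λ b → if b then choice i (ρs i) v else ρs i v) (dec-true (pos v ≟ i) v-at-i)

  ρs-elsewhere : ∀ {v i} → pos v ≢ i → ρs (suc i) v ≡ ρs i v
  ρs-elsewhere {v} {i} v-not-at-i = cong (λ b → if b then choice i (ρs i) v else ρs i v) (dec-false (pos v ≟ i) v-not-at-i)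

  ρs-step : ∀ {u i} → pos u ≡ i → ∀ v → ρs (suc i) v ≡ update G (ρs i) u (choice i (ρs i) u) v
  ρs-step {u} u-at-i v with v Fin.≟ u
  ... | yes refl = ρs-here u-at-i
  ... | no v≢u = ρs-elsewhere λ v-at-i → v≢u (pos-injective (trans v-at-i (sym u-at-i)))

  ρs-final : ∀ v {j} → pos v < j → ρs j v ≡ choice (pos v) (ρs (pos v)) v
  ρs-final v {suc j} v<1+j with pos v ≟ j
  ... | yes refl = ρs-here refl
  ... | no v≢j = trans (ρs-elsewhere v≢j) (ρs-final v (≤∧≢⇒< (s≤s⁻¹ v<1+j) v≢j))

  module Run (2≤d : ∀ u → 2 ≤ degree G u) where

    Invariant : ℕ → Set
    Invariant i = ConflictFree G π (ρs i) i × (∀ v → i ≤ pos v → ρs i v ≡ 0)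

    invariant : ∀ i → i ≤ n → Invariant i
    invariant zero _ = (λ _ _ ()) , λ _ _ → refl
    invariant (suc i) i<n = conflictFree-cong (suc i) (sym ∘ ρs-step u-at-i) (proj₁ spec) , later-zero
      where
      u : Fin n
      u = π ⟨$⟩ʳ fromℕ< i<n
      u-at-i : pos u ≡ i
      u-at-i = trans (pos-ord (fromℕ< i<n)) (toℕ-fromℕ< i<n)
      previous : Invariant i
      previous = invariant i (<⇒≤ i<n)
      spec : GoodChoice i (ρs i) u (choice i (ρs i) u)
      spec = choice-spec u-at-i (2≤d u) (proj₁ previous) (proj₂ previous u (≤-reflexive (sym u-at-i)))
      later-zero : ∀ v → suc i ≤ pos v → ρs (suc i) v ≡ 0
      later-zero v i<v = trans (ρs-step u-at-i v) (trans (update-other (ρs i) u _ v≢u) (proj₂ previous v (<⇒≤ i<v)))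
        where
        v≢u : v ≢ u
        v≢u refl = <-irrefl (sym u-at-i) i<v

    choice-spec-at : ∀ {u i} → pos u ≡ i → GoodChoice i (ρs i) u (choice i (ρs i) u)
    choice-spec-at {u} refl = choice-spec refl (2≤d u) (proj₁ previous) (proj₂ previous u ≤-refl)
      where
      previous : Invariant (pos u)
      previous = invariant (pos u) (<⇒≤ (toℕ<n _))

    chosen : ∀ p → ρs (suc (toℕ p)) (ord G π p) ≡ choice (toℕ p) (ρs (toℕ p)) (ord G π p)
    chosen p = trans (ρs-step (pos-ord p) (ord G π p)) (update-self (ρs (toℕ p)) (ord G π p) _)

    run : GreedyRun G π ρs
    run = record
      { start = λ _ → refl
      ; keep = λ p v v≢ → ρs-elsewhere λ eq → v≢ (pos-injective (trans eq (sym (pos-ord p))))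
      ; valid = λ p → proj₁ (invariant (suc (toℕ p)) (toℕ<n p))
      ; least = λ p s s<ρ → proj₂ (proj₂ (choice-spec-at (pos-ord p))) (subst (s <_) (chosen p) s<ρ)
      }

    proper : ProperPushingScheme G (ρs n)
    proper v w vw = conflictFree-vertices (proj₁ (invariant n ≤-refl)) (toℕ<n _) (toℕ<n _) vw

    ρs-bound : ∀ v → ρs n v ≤ greedyBound (pos v) v
    ρs-bound v = subst (_≤ greedyBound (pos v) v) (sym (ρs-final v (toℕ<n _))) (proj₁ (proj₂ (choice-spec-at {v} refl)))

  laterNbr : Fin n → Fin n → Bool
  laterNbr w u = adj G w u ∧ (pos w <ᵇ pos u)

  localLoad : Fin n → ℕ
  localLoad w = count (earlierNbr (pos w) w) + ∑[ u ∈ laterNbr w ] count (earlierNbr (pos u) w)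

  -- The summands 1 of greedyBound (pos u) u stay with u; each count (earlierNbr (pos u) w) moves to the
  -- earlier neighbour w.
  ∑-greedyBound : ∑[ u < n ] greedyBound (pos u) u ≡ ∑[ w < n ] localLoad w
  ∑-greedyBound = begin
    ∑[ u < n ] greedyBound (pos u) u
      ≡⟨ sum-cong-≗ (λ u → sumOver-+ (earlierNbr (pos u) u) (λ _ → 1) (λ w → count (earlierNbr (pos u) w))) ⟩
    ∑[ u < n ] (count (earlierNbr (pos u) u) + ∑[ w ∈ earlierNbr (pos u) u ] count (earlierNbr (pos u) w))
      ≡⟨ ∑-distrib-+ (λ u → count (earlierNbr (pos u) u)) _ ⟩
    ∑[ u < n ] count (earlierNbr (pos u) u) + ∑[ u < n ] ∑[ w ∈ earlierNbr (pos u) u ] count (earlierNbr (pos u) w)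
      ≡⟨ cong (∑[ u < n ] count (earlierNbr (pos u) u) +_) reindex ⟩
    ∑[ w < n ] count (earlierNbr (pos w) w) + ∑[ w < n ] ∑[ u ∈ laterNbr w ] count (earlierNbr (pos u) w)
      ≡⟨ ∑-distrib-+ (λ w → count (earlierNbr (pos w) w)) _ ⟨
    ∑[ w < n ] localLoad w ∎
    where
    open ≡-Reasoning
    reindex : ∑[ u < n ] ∑[ w ∈ earlierNbr (pos u) u ] count (earlierNbr (pos u) w)
            ≡ ∑[ w < n ] ∑[ u ∈ laterNbr w ] count (earlierNbr (pos u) w)
    reindex = trans (∑-comm (λ u → restrict (earlierNbr (pos u) u) (λ w → count (earlierNbr (pos u) w))))
      (sum-cong-≗ λ w → sum-cong-≗ λ u → cong (λ b → if b ∧ (pos w <ᵇ pos u) then count (earlierNbr (pos u) w) else 0) (symm G u w))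

-- The load of a vertex of a cubic graph

∀-Bool? : {P : Bool → Set} → Decidable P → Dec (∀ b → P b)
∀-Bool? P? with P? false | P? true
... | yes pf | yes pt = yes λ { false → pf ; true → pt }
... | no ¬pf | _ = no λ all → ¬pf (all false)
... | yes _ | no ¬pt = no λ all → ¬pt (all true)

earlierAmong : ℕ → ℕ → ℕ → ℕ → ℕ
earlierAmong i pa pb pc = 𝟙 (pa <ᵇ i) + 𝟙 (pb <ᵇ i) + 𝟙 (pc <ᵇ i)

-- localLoad of a vertex at position p whose neighbours are at positions pa, pb and pc
starLoad : ℕ → ℕ → ℕ → ℕ → ℕ
starLoad p pa pb pc = earlierAmong p pa pb pc + (ifLater pa + ifLater pb + ifLater pc)
  where
  ifLater : ℕ → ℕ
  ifLater q = if p <ᵇ q then earlierAmong q pa pb pc else 0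

-- starLoad in terms of the relative order: la says that a comes after the centre, ab that a comes before b, etc.
loadPattern : Bool → Bool → Bool → Bool → Bool → Bool → ℕ
loadPattern la lb lc ab ac bc = 𝟙 (not la) + 𝟙 (not lb) + 𝟙 (not lc)
  + ((if la then 0 + 𝟙 (not ab) + 𝟙 (not ac) else 0)
   + (if lb then 𝟙 ab + 0 + 𝟙 (not bc) else 0)
   + (if lc then 𝟙 ac + 𝟙 bc + 0 else 0))

starLoad≡loadPattern : ∀ {p pa pb pc} → p ≢ pa → p ≢ pb → p ≢ pc → pa ≢ pb → pa ≢ pc → pb ≢ pc →
  starLoad p pa pb pc ≡ loadPattern (p <ᵇ pa) (p <ᵇ pb) (p <ᵇ pc) (pa <ᵇ pb) (pa <ᵇ pc) (pb <ᵇ pc)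
starLoad≡loadPattern {p} {pa} {pb} {pc} p≢a p≢b p≢c a≢b a≢c b≢c
  rewrite <ᵇ-flip p≢a | <ᵇ-flip p≢b | <ᵇ-flip p≢c | <ᵇ-flip a≢b | <ᵇ-flip a≢c | <ᵇ-flip b≢c
        | <ᵇ-false (<-irrefl {pa} refl) | <ᵇ-false (<-irrefl {pb} refl) | <ᵇ-false (<-irrefl {pc} refl) = refl

loadPattern≤4 : ∀ la lb lc ab ac bc → loadPattern la lb lc ab ac bc ≤ 4
loadPattern≤4 = toWitness {a? = ∀-Bool? λ la → ∀-Bool? λ lb → ∀-Bool? λ lc → ∀-Bool? λ ab → ∀-Bool? λ ac → ∀-Bool? λ bc →
  loadPattern la lb lc ab ac bc ≤? 4} _

loadPattern-allLater : ∀ {la lb lc} → la ≡ true → lb ≡ true → lc ≡ true → ∀ ab ac bc → loadPattern la lb lc ab ac bc ≤ 3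
loadPattern-allLater refl refl refl =
  toWitness {a? = ∀-Bool? λ ab → ∀-Bool? λ ac → ∀-Bool? λ bc → loadPattern true true true ab ac bc ≤? 3} _

loadPattern-allEarlier : ∀ {la lb lc} → la ≡ false → lb ≡ false → lc ≡ false → ∀ ab ac bc → loadPattern la lb lc ab ac bc ≤ 3
loadPattern-allEarlier refl refl refl =
  toWitness {a? = ∀-Bool? λ ab → ∀-Bool? λ ac → ∀-Bool? λ bc → loadPattern false false false ab ac bc ≤? 3} _

module CubicLoad {n : ℕ} (G : Graph n) (cubic : Cubic G) (π : Permutation′ n) where

  open GraphBasics G
  open GreedyAlgorithm G π

  open CubicGraph G cubic

  module _ (w : Fin n) where
    open ThreeElements (neighbours w)

    count-earlierNbr : ∀ i → count (earlierNbr i w) ≡ earlierAmong i (pos a) (pos b) (pos c)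
    count-earlierNbr i = trans (sumOver-∧ (adj G w) (λ x → pos x <ᵇ i) (λ _ → 1)) (sumOver-elements (λ x → 𝟙 (pos x <ᵇ i)))

    localLoad≡loadPattern : localLoad w ≡
      loadPattern (pos w <ᵇ pos a) (pos w <ᵇ pos b) (pos w <ᵇ pos c) (pos a <ᵇ pos b) (pos a <ᵇ pos c) (pos b <ᵇ pos c)
    localLoad≡loadPattern = begin
      localLoad w
        ≡⟨ cong₂ _+_ (count-earlierNbr (pos w)) (sumOver-∧ (adj G w) (λ u → pos w <ᵇ pos u) (λ u → count (earlierNbr (pos u) w))) ⟩
      earlierAmong (pos w) (pos a) (pos b) (pos c) + ∑[ u ∈ adj G w ] ifLater u
        ≡⟨ cong (earlierAmong (pos w) (pos a) (pos b) (pos c) +_) (sumOver-elements ifLater) ⟩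
      earlierAmong (pos w) (pos a) (pos b) (pos c) + (ifLater a + ifLater b + ifLater c)
        ≡⟨ cong (λ k → earlierAmong (pos w) (pos a) (pos b) (pos c) + k) (cong₂ _+_ (cong₂ _+_ (counted a) (counted b)) (counted c)) ⟩
      starLoad (pos w) (pos a) (pos b) (pos c)
        ≡⟨ starLoad≡loadPattern (w≢ pa) (w≢ pb) (w≢ pc) (≢-pos a≢b) (≢-pos a≢c) (≢-pos b≢c) ⟩
      loadPattern (pos w <ᵇ pos a) (pos w <ᵇ pos b) (pos w <ᵇ pos c) (pos a <ᵇ pos b) (pos a <ᵇ pos c) (pos b <ᵇ pos c) ∎
      where
      open ≡-Reasoning
      ifLater : Fin n → ℕ
      ifLater u = if pos w <ᵇ pos u then count (earlierNbr (pos u) w) else 0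
      counted : ∀ u → ifLater u ≡ (if pos w <ᵇ pos u then earlierAmong (pos u) (pos a) (pos b) (pos c) else 0)
      counted u = cong (if pos w <ᵇ pos u then_else 0) (count-earlierNbr (pos u))
      ≢-pos : ∀ {x y} → x ≢ y → pos x ≢ pos y
      ≢-pos x≢y = x≢y ∘ pos-injective
      w≢ : ∀ {x} → adj G w x ≡ true → pos w ≢ pos x
      w≢ wx = ≢-pos (adj⇒≢ wx)

    localLoad≤4 : localLoad w ≤ 4
    localLoad≤4 = ≤-trans (≤-reflexive localLoad≡loadPattern)
      (loadPattern≤4 (pos w <ᵇ pos a) (pos w <ᵇ pos b) (pos w <ᵇ pos c) (pos a <ᵇ pos b) (pos a <ᵇ pos c) (pos b <ᵇ pos c))

    localLoad-allLater : (∀ {x} → adj G w x ≡ true → pos w < pos x) → localLoad w ≤ 3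
    localLoad-allLater later = ≤-trans (≤-reflexive localLoad≡loadPattern)
      (loadPattern-allLater (<ᵇ-true (later pa)) (<ᵇ-true (later pb)) (<ᵇ-true (later pc))
        (pos a <ᵇ pos b) (pos a <ᵇ pos c) (pos b <ᵇ pos c))

    localLoad-allEarlier : (∀ {x} → adj G w x ≡ true → pos x < pos w) → localLoad w ≤ 3
    localLoad-allEarlier earlier = ≤-trans (≤-reflexive localLoad≡loadPattern)
      (loadPattern-allEarlier (<ᵇ-false (<⇒≯ (earlier pa))) (<ᵇ-false (<⇒≯ (earlier pb))) (<ᵇ-false (<⇒≯ (earlier pc)))
        (pos a <ᵇ pos b) (pos a <ᵇ pos c) (pos b <ᵇ pos c))

-- Sorting permutations

injective⇒surjective : (f : Fin n → Fin n) → (∀ {x y} → f x ≡ f y → x ≡ y) → ∀ p → ∃[ v ] f v ≡ p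
injective⇒surjective {suc m} f f-inj p with any? (λ v → f v Fin.≟ p)
... | yes hit = hit
... | no miss = contradiction (injective⇒≤ g-inj) (<-irrefl refl)
  where
  g : Fin (suc m) → Fin m
  g v = punchOut (λ fv≡p → miss (v , sym fv≡p))
  g-inj : ∀ {x y} → g x ≡ g y → x ≡ y
  g-inj {x} {y} = f-inj ∘ punchOut-injective (λ e → miss (x , sym e)) (λ e → miss (y , sym e))

injective⇒permutation : (f : Fin n → Fin n) → (∀ {x y} → f x ≡ f y → x ≡ y) → Σ[ π ∈ Permutation′ n ] (∀ v → π ⟨$⟩ˡ v ≡ f v)
injective⇒permutation {n} f f-inj = permutation section f (f-inj ∘ proj₂ ∘ surj ∘ f) (proj₂ ∘ surj) , λ _ → refl
  where
  surj : ∀ p → ∃[ v ] f v ≡ p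
  surj = injective⇒surjective f f-inj
  section : Fin n → Fin n
  section = proj₁ ∘ surj

-- Positions are ranks with respect to the injective key r v * n + v, which refines r.
sorting-permutation : (r : Fin n → ℕ) → Σ[ π ∈ Permutation′ n ] (∀ v w → r v < r w → toℕ (π ⟨$⟩ˡ v) < toℕ (π ⟨$⟩ˡ w))
sorting-permutation {n} r = π , λ v w rv<rw → subst₂ _<_ (sym (rank-pos v)) (sym (rank-pos w)) (rank-mono (key-mono rv<rw))
  where
  key : Fin n → ℕ
  key v = r v * n + toℕ v

  key-mono : ∀ {v w} → r v < r w → key v < key w
  key-mono {v} {w} rv<rw = begin-strict
    r v * n + toℕ v  <⟨ +-monoʳ-< (r v * n) (toℕ<n v) ⟩
    r v * n + n      ≡⟨ +-comm (r v * n) n ⟩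
    suc (r v) * n    ≤⟨ *-monoˡ-≤ n rv<rw ⟩
    r w * n          ≤⟨ m≤m+n (r w * n) (toℕ w) ⟩
    key w            ∎
    where open ≤-Reasoning

  key-injective : ∀ {v w} → key v ≡ key w → v ≡ w
  key-injective {v} {w} eq with <-cmp (r v) (r w)
  ... | tri< rv<rw _ _ = contradiction eq (<⇒≢ (key-mono rv<rw))
  ... | tri> _ _ rw<rv = contradiction (sym eq) (<⇒≢ (key-mono rw<rv))
  ... | tri≈ _ rv≡rw _ = toℕ-injective (+-cancelˡ-≡ (r v * n) _ _ (trans eq (cong (λ k → k * n + toℕ w) (sym rv≡rw))))

  rank : Fin n → ℕ
  rank v = ∑[ w < n ] 𝟙 (key w <ᵇ key v)

  rank-mono : ∀ {v w} → key v < key w → rank v < rank w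
  rank-mono {v} {w} kv<kw = ∑-mono-< pointwise v
    (subst₂ _<_ (sym (cong 𝟙 (<ᵇ-false {key v} (<-irrefl refl)))) (sym (cong 𝟙 (<ᵇ-true kv<kw))) (s≤s z≤n))
    where
    pointwise : ∀ x → 𝟙 (key x <ᵇ key v) ≤ 𝟙 (key x <ᵇ key w)
    pointwise x with key x <ᵇ key v | <ᵇ-reflects-< (key x) (key v) | key x <ᵇ key w | <ᵇ-reflects-< (key x) (key w)
    ... | true | _ | true | _ = ≤-refl
    ... | true | ofʸ kx<kv | false | ofⁿ kx≮kw = contradiction (<-trans kx<kv kv<kw) kx≮kw
    ... | false | _ | _ | _ = z≤n

  rank<n : ∀ v → rank v < n
  rank<n v = subst (rank v <_) (trans (∑-const n 1) (*-identityʳ n))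
    (∑-mono-< (λ x → 𝟙≤1 (key x <ᵇ key v)) v (subst (_< 1) (sym (cong 𝟙 (<ᵇ-false {key v} (<-irrefl refl)))) (s≤s z≤n)))

  position : Fin n → Fin n
  position v = fromℕ< (rank<n v)

  rank-pos : ∀ v → toℕ (position v) ≡ rank v
  rank-pos v = toℕ-fromℕ< (rank<n v)

  position-injective : ∀ {v w} → position v ≡ position w → v ≡ w
  position-injective {v} {w} eq with <-cmp (key v) (key w)
  ... | tri< kv<kw _ _ = contradiction (trans (sym (rank-pos v)) (trans (cong toℕ eq) (rank-pos w))) (<⇒≢ (rank-mono kv<kw))
  ... | tri≈ _ kv≡kw _ = key-injective kv≡kw
  ... | tri> _ _ kw<kv = contradiction (trans (sym (rank-pos w)) (trans (cong toℕ (sym eq)) (rank-pos v))) (<⇒≢ (rank-mono kw<kv))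

  π : Permutation′ n
  π = proj₁ (injective⇒permutation position position-injective)

-- Partitions into sources, middle vertices and sinks

ascend : {A : Set} {Good Done : A → Set} (Φ : A → ℕ) (B : ℕ) → (∀ {x} → Good x → Φ x ≤ B) →
  (∀ {x} → Good x → Done x ⊎ ∃[ y ] (Good y × Φ x < Φ y)) → ∀ {x} → Good x → ∃[ y ] (Good y × Done y)
ascend {Good = Good} {Done} Φ B bounded improve {x} good-x = climb (suc B) good-x (m≤n+m (suc B) (Φ x))
  where
  climb : ∀ k {x} → Good x → B < Φ x + k → ∃[ y ] (Good y × Done y)
  climb zero {x} good-x B<Φx = contradiction (bounded good-x) (<⇒≱ (subst (B <_) (+-identityʳ (Φ x)) B<Φx))
  climb (suc k) {x} good-x B<Φx+1+k with improve good-x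
  ... | inj₁ done-x = x , good-x , done-x
  ... | inj₂ (y , good-y , Φx<Φy) = climb k good-y (≤-trans B<Φx+1+k (≤-trans (≤-reflexive (+-suc (Φ x) k)) (+-monoˡ-≤ k Φx<Φy)))

data Role : Set where
  source middle sink : Role

_≟ᴿ_ : DecidableEquality Role
source ≟ᴿ source = yes refl
source ≟ᴿ middle = no λ ()
source ≟ᴿ sink = no λ ()
middle ≟ᴿ source = no λ ()
middle ≟ᴿ middle = yes refl
middle ≟ᴿ sink = no λ ()
sink ≟ᴿ source = no λ ()
sink ≟ᴿ middle = no λ ()
sink ≟ᴿ sink = yes refl

weight : Role → ℕ
weight source = 2
weight middle = 0
weight sink = 1

module Partition {n : ℕ} (G : Graph n) where

  open GraphBasics G

  -- sources form an independent set, and so do sinks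
  Stable : (Fin n → Role) → Set
  Stable role = ∀ {v w} → adj G v w ≡ true → role v ≡ role w → role v ≡ middle

  HasNeighbour : (Fin n → Role) → Role → Fin n → Set
  HasNeighbour role r v = ∃[ w ] (adj G v w ≡ true × role w ≡ r)

  hasNeighbour? : ∀ role r v → Dec (HasNeighbour role r v)
  hasNeighbour? role r v = any? λ w → (adj G v w Bool.≟ true) ×-dec (role w ≟ᴿ r)

  sinkDegree : (Fin n → Role) → Fin n → ℕ
  sinkDegree role x = ∑[ y ∈ adj G x ] 𝟙 (does (role y ≟ᴿ sink))

  Swappable : (Fin n → Role) → Fin n → Fin n → Fin n → Set
  Swappable role t x y = role t ≡ sink × adj G t x ≡ true × adj G t y ≡ true × x ≢ y
    × role x ≡ middle × role y ≡ middle × sinkDegree role x ≡ 1 × sinkDegree role y ≡ 1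

  swappable? : ∀ role t x y → Dec (Swappable role t x y)
  swappable? role t x y = (role t ≟ᴿ sink) ×-dec (adj G t x Bool.≟ true) ×-dec (adj G t y Bool.≟ true) ×-dec ¬? (x Fin.≟ y)
    ×-dec (role x ≟ᴿ middle) ×-dec (role y ≟ᴿ middle) ×-dec (sinkDegree role x ≟ 1) ×-dec (sinkDegree role y ≟ 1)

  record Saturated (role : Fin n → Role) : Set where
    field
      dominated : ∀ {v} → role v ≢ source → HasNeighbour role source v
      covered : ∀ {v} → role v ≡ middle → HasNeighbour role sink v
      unswappable : ∀ {t x y} → ¬ Swappable role t x y

  potential : (Fin n → Role) → ℕ
  potential role = ∑[ v < n ] weight (role v)

  potential≤2n : ∀ role → potential role ≤ 2 * n
  potential≤2n role = subst (potential role ≤_) (trans (∑-const n 2) (*-comm n 2)) (∑-mono-≤ (weight≤2 ∘ role))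
    where
    weight≤2 : ∀ r → weight r ≤ 2
    weight≤2 source = ≤-refl
    weight≤2 middle = z≤n
    weight≤2 sink = s≤s z≤n

  _[_≔_] : (Fin n → Role) → Fin n → Role → Fin n → Role
  role [ v ≔ r ] = updateAt role v (const r)

  module _ (role : Fin n → Role) (v : Fin n) (r : Role) where

    assigned : (role [ v ≔ r ]) v ≡ r
    assigned = updateAt-updates v role

    unassigned : ∀ {z} → z ≢ v → (role [ v ≔ r ]) z ≡ role z
    unassigned z≢v = updateAt-minimal _ v role z≢v

    potential-assign : potential (role [ v ≔ r ]) + weight (role v) ≡ potential role + weight r
    potential-assign = trans (∑-agree v (λ z z≢v → cong weight (unassigned z≢v))) (cong (λ r′ → potential role + weight r′) assigned)

  assign-improves : ∀ {role v r} → Stable role → ¬ HasNeighbour role r v → weight (role v) < weight r →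
    Stable (role [ v ≔ r ]) × potential role < potential (role [ v ≔ r ])
  assign-improves {role} {v} {r} stable no-r-nbr lighter = stable′ , +-cancelʳ-< _ _ _ (begin-strict
      potential role + weight (role v)         <⟨ +-monoʳ-< (potential role) lighter ⟩
      potential role + weight r                ≡⟨ potential-assign role v r ⟨
      potential (role [ v ≔ r ]) + weight (role v) ∎)
    where
    open ≤-Reasoning
    stable′ : Stable (role [ v ≔ r ])
    stable′ {z₁} {z₂} z₁z₂ same with z₁ Fin.≟ v | z₂ Fin.≟ v
    ... | yes refl | yes refl = contradiction refl (adj⇒≢ z₁z₂)
    ... | yes refl | no z₂≢v = contradiction (z₂ , z₁z₂ , trans (sym (unassigned role v r z₂≢v)) (trans (sym same) (assigned role v r))) no-r-nbr
    ... | no z₁≢v | yes refl =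
      contradiction (z₁ , trans (symm G v z₁) z₁z₂ , trans (sym (unassigned role v r z₁≢v)) (trans same (assigned role v r))) no-r-nbr
    ... | no z₁≢v | no z₂≢v rewrite unassigned role v r z₁≢v | unassigned role v r z₂≢v = stable z₁z₂ same

  private-only : ∀ {role m t z} → sinkDegree role m ≡ 1 → adj G m t ≡ true → role t ≡ sink →
    adj G m z ≡ true → role z ≡ sink → z ≡ t
  private-only {role} {m} {t} {z} degree≡1 mt t-sink mz z-sink with ∖-cases (adj G m) {a = t} mz
  ... | inj₁ z≡t = z≡t
  ... | inj₂ m∖t-z = contradiction (begin
      2                                                     ≡⟨ cong₂ _+_ (is-sink t-sink) (is-sink z-sink) ⟨
      isSink t + isSink z                                   ≤⟨ +-monoʳ-≤ (isSink t) (≤-sumOver (adj G m ∖ t) m∖t-z isSink) ⟩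
      isSink t + ∑[ y ∈ adj G m ∖ t ] isSink y              ≡⟨ sumOver-remove (adj G m) mt isSink ⟨
      sinkDegree role m                                     ≡⟨ degree≡1 ⟩
      1                                                     ∎) (λ { (s≤s ()) })
    where
    open ≤-Reasoning
    isSink : Fin n → ℕ
    isSink y = 𝟙 (does (role y ≟ᴿ sink))
    is-sink : ∀ {y} → role y ≡ sink → isSink y ≡ 1
    is-sink y-sink = cong 𝟙 (dec-true (_ ≟ᴿ sink) y-sink)

  module Swap (no-triangle : NoTriangle G) {role t x y} (stable : Stable role)
    (t-sink : role t ≡ sink) (tx : adj G t x ≡ true) (ty : adj G t y ≡ true) (x≢y : x ≢ y)
    (x-middle : role x ≡ middle) (y-middle : role y ≡ middle) (x-private : sinkDegree role x ≡ 1) (y-private : sinkDegree role y ≡ 1) where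

    role₁ role₂ swapped : Fin n → Role
    role₁ = role [ t ≔ middle ]
    role₂ = role₁ [ x ≔ sink ]
    swapped = role₂ [ y ≔ sink ]

    t≢x : t ≢ x
    t≢x = adj⇒≢ tx
    t≢y : t ≢ y
    t≢y = adj⇒≢ ty

    swapped-t : swapped t ≡ middle
    swapped-t = trans (unassigned role₂ y sink t≢y) (trans (unassigned role₁ x sink t≢x) (assigned role t middle))

    swapped-other : ∀ {z} → z ≢ t → z ≢ x → z ≢ y → swapped z ≡ role z
    swapped-other z≢t z≢x z≢y = trans (unassigned role₂ y sink z≢y) (trans (unassigned role₁ x sink z≢x) (unassigned role t middle z≢t))

    data SwappedSink (z : Fin n) : Set where
      is-x : z ≡ x → SwappedSink z
      is-y : z ≡ y → SwappedSink z
      old : z ≢ t → role z ≡ sink → SwappedSink z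

    swapped-sink : ∀ {z} → swapped z ≡ sink → SwappedSink z
    swapped-sink {z} z-sink with z Fin.≟ y | z Fin.≟ x | z Fin.≟ t
    ... | yes z≡y | _ | _ = is-y z≡y
    ... | no _ | yes z≡x | _ = is-x z≡x
    ... | no _ | no _ | yes refl = contradiction (trans (sym swapped-t) z-sink) λ ()
    ... | no z≢y | no z≢x | no z≢t = old z≢t (trans (sym (swapped-other z≢t z≢x z≢y)) z-sink)

    swapped-source : ∀ {z} → swapped z ≡ source → role z ≡ source
    swapped-source {z} z-source with z Fin.≟ y | z Fin.≟ x | z Fin.≟ t
    ... | yes refl | _ | _ = contradiction (trans (sym (assigned role₂ y sink)) z-source) λ ()
    ... | no z≢y | yes refl | _ = contradiction (trans (sym (trans (unassigned role₂ y sink z≢y) (assigned role₁ x sink))) z-source) λ ()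
    ... | no _ | no _ | yes refl = contradiction (trans (sym swapped-t) z-source) λ ()
    ... | no z≢y | no z≢x | no z≢t = trans (sym (swapped-other z≢t z≢x z≢y)) z-source

    -- an old sink next to x or y would be a second sink neighbour besides t
    private-vs-old : ∀ {m z} → (m ≡ x ⊎ m ≡ y) → adj G m z ≡ true → z ≢ t → role z ≡ sink → ⊥
    private-vs-old (inj₁ refl) mz z≢t z-sink = z≢t (private-only x-private (trans (symm G x t) tx) t-sink mz z-sink)
    private-vs-old (inj₂ refl) mz z≢t z-sink = z≢t (private-only y-private (trans (symm G y t) ty) t-sink mz z-sink)

    sinks-independent : ∀ {z₁ z₂} → adj G z₁ z₂ ≡ true → SwappedSink z₁ → SwappedSink z₂ → ⊥
    sinks-independent z₁z₂ (is-x refl) (is-x refl) = adj⇒≢ z₁z₂ refl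
    sinks-independent z₁z₂ (is-y refl) (is-y refl) = adj⇒≢ z₁z₂ refl
    sinks-independent z₁z₂ (is-x refl) (is-y refl) = no-triangle t x y tx z₁z₂ (trans (symm G y t) ty)
    sinks-independent z₁z₂ (is-y refl) (is-x refl) = no-triangle t y x ty z₁z₂ (trans (symm G x t) tx)
    sinks-independent z₁z₂ (is-x x≡) (old z≢t z-sink) = private-vs-old (inj₁ x≡) z₁z₂ z≢t z-sink
    sinks-independent z₁z₂ (is-y y≡) (old z≢t z-sink) = private-vs-old (inj₂ y≡) z₁z₂ z≢t z-sink
    sinks-independent z₁z₂ (old z≢t z-sink) (is-x x≡) = private-vs-old (inj₁ x≡) (trans (symm G _ _) z₁z₂) z≢t z-sink
    sinks-independent z₁z₂ (old z≢t z-sink) (is-y y≡) = private-vs-old (inj₂ y≡) (trans (symm G _ _) z₁z₂) z≢t z-sink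
    sinks-independent z₁z₂ (old _ z₁-sink) (old _ z₂-sink) =
      contradiction (trans (sym z₁-sink) (stable z₁z₂ (trans z₁-sink (sym z₂-sink)))) λ ()

    stable′ : Stable swapped
    stable′ {z₁} {z₂} z₁z₂ same = by-role (swapped z₁) refl
      where
      by-role : ∀ r → swapped z₁ ≡ r → swapped z₁ ≡ middle
      by-role middle z₁-middle = z₁-middle
      by-role source z₁-source = contradiction (trans (sym (swapped-source z₁-source)) (stable z₁z₂ (trans (swapped-source z₁-source)
                                   (sym (swapped-source (trans (sym same) z₁-source)))))) λ ()
      by-role sink z₁-sink = ⊥-elim (sinks-independent z₁z₂ (swapped-sink z₁-sink) (swapped-sink (trans (sym same) z₁-sink)))

    potential-increases : potential role < potential swapped
    potential-increases = ≤-reflexive (sym (begin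
      potential swapped                ≡⟨ +-identityʳ _ ⟨
      potential swapped + 0            ≡⟨ potential-assign′ role₂ y sink y-middle₂ ⟩
      potential role₂ + 1              ≡⟨ cong (_+ 1) (+-identityʳ _) ⟨
      potential role₂ + 0 + 1          ≡⟨ cong (_+ 1) (potential-assign′ role₁ x sink x-middle₁) ⟩
      potential role₁ + 1 + 1          ≡⟨ cong (_+ 1) (potential-assign′ role t middle t-sink) ⟩
      potential role + 0 + 1           ≡⟨ cong (_+ 1) (+-identityʳ _) ⟩
      potential role + 1               ≡⟨ +-comm (potential role) 1 ⟩
      suc (potential role)             ∎))
      where
      open ≡-Reasoning
      potential-assign′ : ∀ role′ v r {r₀} → role′ v ≡ r₀ → potential (role′ [ v ≔ r ]) + weight r₀ ≡ potential role′ + weight r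
      potential-assign′ role′ v r refl = potential-assign role′ v r
      x-middle₁ : role₁ x ≡ middle
      x-middle₁ = trans (unassigned role t middle (t≢x ∘ sym)) x-middle
      y-middle₂ : role₂ y ≡ middle
      y-middle₂ = trans (unassigned role₁ x sink (x≢y ∘ sym)) (trans (unassigned role t middle (t≢y ∘ sym)) y-middle)

  improve : NoTriangle G → ∀ {role} → Stable role → Saturated role ⊎ ∃[ role′ ] (Stable role′ × potential role < potential role′)
  improve no-triangle {role} stable
    with any? (λ v → ¬? (role v ≟ᴿ source) ×-dec ¬? (hasNeighbour? role source v))
  ... | yes (v , not-source , no-source-nbr) = inj₂ (_ , assign-improves stable no-source-nbr (lighter not-source))
    where
    lighter : ∀ {r} → r ≢ source → weight r < weight source
    lighter {source} r≢source = contradiction refl r≢source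
    lighter {middle} _ = s≤s z≤n
    lighter {sink} _ = s≤s (s≤s z≤n)
  ... | no all-dominated
    with any? (λ v → (role v ≟ᴿ middle) ×-dec ¬? (hasNeighbour? role sink v))
  ... | yes (v , v-middle , no-sink-nbr) =
    inj₂ (_ , assign-improves stable no-sink-nbr (subst (λ r → weight r < weight sink) (sym v-middle) (s≤s z≤n)))
  ... | no all-covered
    with any? (λ t → any? λ x → any? λ y → swappable? role t x y)
  ... | yes (t , x , y , t-sink , tx , ty , x≢y , x-middle , y-middle , x-private , y-private) = inj₂ (swapped , stable′ , potential-increases)
    where open Swap no-triangle stable t-sink tx ty x≢y x-middle y-middle x-private y-private
  ... | no none-swappable = inj₁ record
    { dominated = λ {v} not-source → decidable-stable (hasNeighbour? role source v) λ none → all-dominated (v , not-source , none)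
    ; covered = λ {v} v-middle → decidable-stable (hasNeighbour? role sink v) λ none → all-covered (v , v-middle , none)
    ; unswappable = λ {t} {x} {y} swappable → none-swappable (t , x , y , swappable)
    }

  saturated-partition : NoTriangle G → ∃[ role ] (Stable role × Saturated role)
  saturated-partition no-triangle =
    ascend potential (2 * n) (λ {role} _ → potential≤2n role) (improve no-triangle) {λ _ → middle} λ _ _ → refl

-- Discharging

∀-Role? : {P : Role → Set} → Decidable P → Dec (∀ r → P r)
∀-Role? P? with P? source | P? middle | P? sink
... | yes ps | yes pm | yes pt = yes λ { source → ps ; middle → pm ; sink → pt }
... | no ¬ps | _ | _ = no λ all → ¬ps (all source)
... | yes _ | no ¬pm | _ = no λ all → ¬pm (all middle)
... | yes _ | yes _ | no ¬pt = no λ all → ¬pt (all sink)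

loadBound : Role → ℕ
loadBound source = 3
loadBound middle = 4
loadBound sink = 3

-- Charge sent by a vertex of the first role to a neighbour of the second role; the flag says whether that
-- neighbour is private, i.e. has exactly one sink neighbour.
transfer : Role → Role → Bool → ℕ
transfer source _ _ = 132
transfer sink middle priv = if priv then 311 else 156
transfer _ _ _ = 0

OneOf : Role → Role → Role → Role → Set
OneOf r ra rb rc = ra ≡ r ⊎ rb ≡ r ⊎ rc ≡ r

oneOf? : ∀ r ra rb rc → Dec (OneOf r ra rb rc)
oneOf? r ra rb rc = (ra ≟ᴿ r) ⊎-dec (rb ≟ᴿ r) ⊎-dec (rc ≟ᴿ r)

PrivateMiddle : Role → Bool → Set
PrivateMiddle r priv = r ≡ middle × priv ≡ true

privateMiddle? : ∀ r priv → Dec (PrivateMiddle r priv)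
privateMiddle? r priv = (r ≟ᴿ middle) ×-dec (priv Bool.≟ true)

-- What a saturated role assignment guarantees around a vertex of role r whose neighbours have roles ra, rb, rc
-- and are private as indicated by pa, pb, pc.
SaturatedStar : Role → Role → Role → Role → Bool → Bool → Bool → Set
SaturatedStar r ra rb rc pa pb pc =
    (r ≢ source → OneOf source ra rb rc)
  × (r ≡ middle → OneOf sink ra rb rc)
  × (r ≡ sink → ¬ (PrivateMiddle ra pa × PrivateMiddle rb pb)
              × ¬ (PrivateMiddle ra pa × PrivateMiddle rc pc)
              × ¬ (PrivateMiddle rb pb × PrivateMiddle rc pc))

saturatedStar? : ∀ r ra rb rc pa pb pc → Dec (SaturatedStar r ra rb rc pa pb pc)
saturatedStar? r ra rb rc pa pb pc =
      (¬? (r ≟ᴿ source) →-dec oneOf? source ra rb rc)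
  ×-dec ((r ≟ᴿ middle) →-dec oneOf? sink ra rb rc)
  ×-dec ((r ≟ᴿ sink) →-dec (¬? (privateMiddle? ra pa ×-dec privateMiddle? rb pb) ×-dec ¬? (privateMiddle? ra pa ×-dec privateMiddle? rc pc)
                            ×-dec ¬? (privateMiddle? rb pb ×-dec privateMiddle? rc pc)))

hasOneSink : Role → Role → Role → Bool
hasOneSink ra rb rc = does (𝟙 (does (ra ≟ᴿ sink)) + 𝟙 (does (rb ≟ᴿ sink)) + 𝟙 (does (rc ≟ᴿ sink)) ≟ 1)

StarBalance : Role → Role → Role → Role → Bool → Bool → Bool → Set
StarBalance r ra rb rc pa pb pc =
  840 * loadBound r + (transfer r ra pa + transfer r rb pb + transfer r rc pc)
    ≤ 2917 + (transfer ra r priv + transfer rb r priv + transfer rc r priv)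
  where priv = hasOneSink ra rb rc

star-balance : ∀ r ra rb rc pa pb pc → SaturatedStar r ra rb rc pa pb pc → StarBalance r ra rb rc pa pb pc
star-balance = toWitness {a? =
  ∀-Role? λ r → ∀-Role? λ ra → ∀-Role? λ rb → ∀-Role? λ rc → ∀-Bool? λ pa → ∀-Bool? λ pb → ∀-Bool? λ pc →
  saturatedStar? r ra rb rc pa pb pc →-dec (_ ≤? _)} _

module Discharging {n : ℕ} (G : Graph n) (cubic : Cubic G) (role : Fin n → Role) (saturated : Partition.Saturated G role) where

  open GraphBasics G
  open CubicGraph G cubic
  open Partition G
  open Saturated saturated

  isPrivate : Fin n → Bool
  isPrivate x = does (sinkDegree role x ≟ 1)

  τ : Fin n → Fin n → ℕ
  τ v x = transfer (role v) (role x) (isPrivate x)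

  sent : Fin n → ℕ
  sent w = ∑[ x ∈ adj G w ] τ w x

  received : Fin n → ℕ
  received w = ∑[ x ∈ adj G w ] τ x w

  ∑-sent≡∑-received : ∑[ w < n ] sent w ≡ ∑[ w < n ] received w
  ∑-sent≡∑-received = trans (∑-comm (λ w → restrict (adj G w) (τ w)))
    (sum-cong-≗ λ x → sum-cong-≗ λ w → cong (λ b → if b then τ w x else 0) (symm G w x))

  module _ (w : Fin n) where
    open ThreeElements (neighbours w)

    neighbour-role : ∀ {r x} → adj G w x ≡ true → role x ≡ r → OneOf r (role a) (role b) (role c)
    neighbour-role wx x-r with elements wx
    ... | inj₁ refl = inj₁ x-r
    ... | inj₂ (inj₁ refl) = inj₂ (inj₁ x-r)
    ... | inj₂ (inj₂ refl) = inj₂ (inj₂ x-r)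

    no-private-pair : ∀ {x y} → role w ≡ sink → adj G w x ≡ true → adj G w y ≡ true → x ≢ y →
      ¬ (PrivateMiddle (role x) (isPrivate x) × PrivateMiddle (role y) (isPrivate y))
    no-private-pair {x} {y} w-sink wx wy x≢y ((x-middle , x-private′) , (y-middle , y-private′)) =
      unswappable (w-sink , wx , wy , x≢y , x-middle , y-middle ,
        does≡true⇒ (sinkDegree role x ≟ 1) x-private′ , does≡true⇒ (sinkDegree role y ≟ 1) y-private′)

    saturated-star : SaturatedStar (role w) (role a) (role b) (role c) (isPrivate a) (isPrivate b) (isPrivate c)
    saturated-star =
        (λ not-source → let x , wx , x-source = dominated not-source in neighbour-role wx x-source)
      , (λ w-middle → let x , wx , x-sink = covered w-middle in neighbour-role wx x-sink)
      , (λ w-sink → no-private-pair w-sink pa pb a≢b , no-private-pair w-sink pa pc a≢c , no-private-pair w-sink pb pc b≢c)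

    balance : 840 * loadBound (role w) + sent w ≤ 2917 + received w
    balance = subst₂ (λ out in′ → 840 * loadBound (role w) + out ≤ 2917 + in′)
      (sym (sumOver-elements (τ w)))
      (sym (trans (sumOver-elements (λ x → τ x w))
        (cong (λ p → transfer (role a) (role w) p + transfer (role b) (role w) p + transfer (role c) (role w) p) w-private)))
      (star-balance _ _ _ _ _ _ _ saturated-star)
      where
      w-private : isPrivate w ≡ hasOneSink (role a) (role b) (role c)
      w-private = cong (λ k → does (k ≟ 1)) (sumOver-elements (λ y → 𝟙 (does (role y ≟ᴿ sink))))

  ∑-loadBound : 840 * ∑[ w < n ] loadBound (role w) ≤ 2917 * n
  ∑-loadBound = +-cancelʳ-≤ (∑[ w < n ] sent w) _ _ (begin
    840 * ∑[ w < n ] loadBound (role w) + ∑[ w < n ] sent w  ≡⟨ cong (_+ ∑[ w < n ] sent w) (∑-*ˡ 840 (loadBound ∘ role)) ⟨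
    ∑[ w < n ] (840 * loadBound (role w)) + ∑[ w < n ] sent w ≡⟨ ∑-distrib-+ (λ w → 840 * loadBound (role w)) sent ⟨
    ∑[ w < n ] (840 * loadBound (role w) + sent w)          ≤⟨ ∑-mono-≤ balance ⟩
    ∑[ w < n ] (2917 + received w)                          ≡⟨ ∑-distrib-+ (λ _ → 2917) received ⟩
    ∑[ w < n ] 2917 + ∑[ w < n ] received w                 ≡⟨ cong₂ _+_ (trans (∑-const n 2917) (*-comm n 2917)) (sym ∑-sent≡∑-received) ⟩
    2917 * n + ∑[ w < n ] sent w                            ∎)
    where open ≤-Reasoning

stage : Role → ℕ
stage source = 0
stage middle = 1
stage sink = 2

module SortedRoles {n : ℕ} (G : Graph n) (cubic : Cubic G) (role : Fin n → Role) (stable : Partition.Stable G role)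
  (π : Permutation′ n) (sorted : ∀ v w → stage (role v) < stage (role w) → toℕ (π ⟨$⟩ˡ v) < toℕ (π ⟨$⟩ˡ w)) where

  open GreedyAlgorithm G π
  open CubicLoad G cubic π

  neighbour-role : ∀ {v w r} → adj G v w ≡ true → role v ≡ r → r ≢ middle → role w ≢ r
  neighbour-role vw v-r r≢middle w-r = r≢middle (trans (sym v-r) (stable vw (trans v-r (sym w-r))))

  source-first : ∀ {r} → r ≢ source → stage source < stage r
  source-first {source} r≢source = contradiction refl r≢source
  source-first {middle} _ = s≤s z≤n
  source-first {sink} _ = s≤s z≤n

  sink-last : ∀ {r} → r ≢ sink → stage r < stage sink
  sink-last {source} _ = s≤s z≤n
  sink-last {middle} _ = s≤s (s≤s z≤n)
  sink-last {sink} r≢sink = contradiction refl r≢sink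

  localLoad≤loadBound : ∀ w → localLoad w ≤ loadBound (role w)
  localLoad≤loadBound w with role w in w-role
  ... | source = localLoad-allLater w λ {x} wx →
    sorted w x (subst (λ r → stage r < stage (role x)) (sym w-role) (source-first (neighbour-role wx w-role λ ())))
  ... | middle = localLoad≤4 w
  ... | sink = localLoad-allEarlier w λ {x} wx →
    sorted x w (subst (λ r → stage (role x) < stage r) (sym w-role) (sink-last (neighbour-role wx w-role λ ())))

proposition2 : (n : ℕ) (G : Graph n) → Cubic G → GirthAtLeast5 G →
    ∃[ π ] ∃[ ρs ] (GreedyRun G π ρs × ProperPushingScheme G (ρs n)
    × 840 * sumV G (ρs n) ≤ 2917 * n)
proposition2 n G cubic (no-triangle , _)
  with role , stable , saturated ← Partition.saturated-partition G no-triangle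
  with π , sorted ← sorting-permutation (stage ∘ role) = π , ρs , run , proper , bound
  where
  open GreedyAlgorithm G π
  open Run (λ u → subst (2 ≤_) (sym (cubic u)) (s≤s (s≤s z≤n)))
  open SortedRoles G cubic role stable π sorted
  open Discharging G cubic role saturated
  bound : 840 * sumV G (ρs n) ≤ 2917 * n
  bound = begin
    840 * sumV G (ρs n)                       ≡⟨ cong (840 *_) (listSum-allFin (ρs n)) ⟩
    840 * ∑[ v < n ] ρs n v                   ≤⟨ *-monoʳ-≤ 840 (∑-mono-≤ ρs-bound) ⟩
    840 * ∑[ v < n ] greedyBound (pos v) v    ≡⟨ cong (840 *_) ∑-greedyBound ⟩
    840 * ∑[ w < n ] localLoad w              ≤⟨ *-monoʳ-≤ 840 (∑-mono-≤ localLoad≤loadBound) ⟩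
    840 * ∑[ w < n ] loadBound (role w)       ≤⟨ ∑-loadBound ⟩
    2917 * n                                  ∎
    where open ≤-Reasoning
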